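{- Let $y\in\{1,2\}$ and let $x\geq 2y$ be an even integer. There exists a $(\mathbb Z_2^{x-1}\times\mathbb Z_{2^y}\times\mathbb Z_3,\{2^{2^x-1},3^1\},3,1)$-difference family.
   Context: Let $(G,+)$ be a finite abelian group. A partial spread of $G$ is a family $\Sigma$ of subgroups of $G$ whose members pairwise intersect trivially; it has type $\{n_1^{f_1},\dots,n_t^{f_t}\}$ if it consists of exactly $f_i$ subgroups of order $n_i$ for each $i$ (and no others). For a triple $T=\{a,b,c\}$ of three distinct elements of $G$, $\Delta T$ is the multiset $\{\pm(a-b),\pm(a-c),\pm(b-c)\}$, and for a set $\mathcal T$ of triples, $\Delta\mathcal T$ is the multiset union of the $\Delta T$. For a partial spread $\Sigma$, a $(G,\Sigma,3,1)$-difference family is a set $\mathcal T$ of triples of $G$ with $\Delta\mathcal T=G\setminus\bigcup_{S\in\Sigma}S$ as multisets (each element outside the union occurs exactly once, elements of the union do not occur). A $(G,\tau,3,1)$-difference family is a $(G,\Sigma,3,1)$-difference family for some partial spread $\Sigma$ of $G$ of type $\tau$. -}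

module Defs where

open import Data.Nat using (ℕ; zero; suc; _^_; _∸_; NonZero; _≟_)
open import Data.Nat.DivMod using (_%_; m%n<n)
open import Data.Nat.Properties using (m^n≢0)
open import Data.Fin using (Fin; toℕ; fromℕ<)
import Data.Fin.Properties as FinP
open import Data.Vec using (Vec; zipWith; map; replicate)
import Data.Vec.Properties as VecP
open import Data.Product using (_×_; _,_; Σ)
import Data.Product.Properties as ProdP
open import Data.List using (List; []; _∷_; length; filter; concatMap)
open import Data.List.Membership.Propositional using (_∈_)
open import Data.List.Relation.Unary.Any using (Any)
open import Data.List.Relation.Unary.Unique.Propositional using (Unique)
open import Relation.Binary.PropositionalEquality using (_≡_)
open import Relation.Binary.Definitions using (DecidableEquality)
open import Relation.Nullary using (¬_)
open import Data.Sum using (_⊎_)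

ZMod : ℕ → Set
ZMod n = Fin n

module _ (n : ℕ) .{{_ : NonZero n}} where
  zeroZ : ZMod n
  zeroZ = fromℕ< (m%n<n 0 n)

  addZ : ZMod n → ZMod n → ZMod n
  addZ a b = fromℕ< (m%n<n (toℕ a Data.Nat.+ toℕ b) n)

  negZ : ZMod n → ZMod n
  negZ a = fromℕ< (m%n<n (n ∸ toℕ a) n)

G : ℕ → ℕ → Set
G x y = Vec (ZMod 2) (x ∸ 1) × ZMod (2 ^ y) × ZMod 3

module Grp (x y : ℕ) where
  instance
    nz2y : NonZero (2 ^ y)
    nz2y = m^n≢0 2 y

  0G : G x y
  0G = replicate (x ∸ 1) (zeroZ 2) , zeroZ (2 ^ y) , zeroZ 3

  _+G_ : G x y → G x y → G x y
  (u , a , b) +G (v , c , d) = zipWith (addZ 2) u v , addZ (2 ^ y) a c , addZ 3 b d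

  -G_ : G x y → G x y
  -G (u , a , b) = map (negZ 2) u , negZ (2 ^ y) a , negZ 3 b

  _-G_ : G x y → G x y → G x y
  a -G b = a +G (-G b)

  _≟G_ : DecidableEquality (G x y)
  _≟G_ = ProdP.≡-dec (VecP.≡-dec FinP._≟_) (ProdP.≡-dec FinP._≟_ FinP._≟_)

  IsSubgroup : List (G x y) → Set
  IsSubgroup S = Unique S × (0G ∈ S)
               × (∀ a b → a ∈ S → b ∈ S → (a +G b) ∈ S)
               × (∀ a → a ∈ S → (-G a) ∈ S)

  IsPartialSpread : List (List (G x y)) → Set
  IsPartialSpread Σs =
      (∀ S → S ∈ Σs → IsSubgroup S)
    × (∀ (i j : Fin (length Σs)) → ¬ (i ≡ j) →
         ∀ g → g ∈ Data.List.lookup Σs i → g ∈ Data.List.lookup Σs j → g ≡ 0G)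

  numOfOrder : ℕ → List (List (G x y)) → ℕ
  numOfOrder k Σs = length (filter (λ S → length S ≟ k) Σs)

  HasType : List (List (G x y)) → Set
  HasType Σs = (∀ S → S ∈ Σs → length S ≡ 2 ⊎ length S ≡ 3)
             × numOfOrder 2 Σs ≡ 2 ^ x ∸ 1
             × numOfOrder 3 Σs ≡ 1

  Triple : Set
  Triple = G x y × G x y × G x y

  Distinct : Triple → Set
  Distinct (a , b , c) = ¬ (a ≡ b) × ¬ (a ≡ c) × ¬ (b ≡ c)

  Δ : Triple → List (G x y)
  Δ (a , b , c) = (a -G b) ∷ (b -G a) ∷ (a -G c) ∷ (c -G a) ∷ (b -G c) ∷ (c -G b) ∷ []

  ΔT : List Triple → List (G x y)
  ΔT = concatMap Δ

  count : G x y → List (G x y) → ℕ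
  count g L = length (filter (λ h → g ≟G h) L)

  -- ΔT = G \ ⋃Σ as multisets
  IsDF : List (List (G x y)) → List Triple → Set
  IsDF Σs Ts = (∀ T → T ∈ Ts → Distinct T)
             × (∀ g → (Any (g ∈_) Σs → count g (ΔT Ts) ≡ 0)
                    × (¬ Any (g ∈_) Σs → count g (ΔT Ts) ≡ 1))

  DFExists : Set
  DFExists = Σ (List (List (G x y))) λ Σs → Σ (List Triple) λ Ts →
               IsPartialSpread Σs × HasType Σs × IsDF Σs Ts

{-# OPTIONS --safe #-}
module Submission where

-- Write G = ℤ₂ⁿ × ℤ_{2^y} × ℤ₃ (n = x − 1) and let H be the subgroup of order 2 of ℤ_{2^y}.
-- The spread is {0} × {0} × ℤ₃ together with the subgroups ⟨h⟩ generated by the 2^x − 1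
-- involutions h, which are the nonzero elements of ℤ₂ⁿ × H × {0}. All blocks have the form
-- {0, a, b}. Besides such "starter" blocks we carry auxiliary pairs (a , b) such that each of
-- the three lists ±a, ±b, ±(a − b) meets every element of ℤ₂ⁿ × ((ℤ_{2^y} × ℤ₃) ∖ (H × {0}))
-- exactly once. To pass from n to n + 2, read the two new coordinates as an element of 𝔽₄.
-- Old starters get prefix 0, and each pair gives the new starter {0, (1, a), (ω, b)}, whose
-- three difference classes carry the prefixes 1, ω, ω², i.e. all nonzero ones. The new pairs
-- are ((w, a) , (ωw, b)) for w ∈ 𝔽₄: their difference classes carry the prefixes w, ωw and
-- w − ωw = ω²w, each of which runs once through 𝔽₄ with w, so the invariant survives. The
-- recursion starts from configurations for (x , y) = (2 , 1) and (4 , 2), checked by computation.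

open import Defs
open import Algebra.Definitions using (LeftIdentity; RightIdentity; RightInverse)
import Algebra.Properties.CommutativeSemigroup as CommutativeSemigroupProperties
open import Data.Bool using (true; false; if_then_else_)
open import Data.Empty using (⊥-elim)
open import Data.Fin using (Fin; toℕ; fromℕ<)
import Data.Fin as Fin
import Data.Fin.Properties as FinP
open import Data.List using (List; []; _∷_; _++_; length; filter; map; concatMap; lookup; allFin; cartesianProduct)
open import Data.List.Properties using (length-++; length-map; filter-++; concatMap-++; concatMap-map; concatMap-cong; map-concatMap)
open import Data.List.Membership.Propositional using (_∈_; lose)
open import Data.List.Membership.Propositional.Properties
  using (∈-map⁺; ∈-map⁻; ∈-++⁺ˡ; ∈-++⁺ʳ; ∈-++⁻; ∈-lookup; ∈-allFin; ∈-concatMap⁺; ∈-cartesianProduct⁺)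
open import Data.List.Relation.Binary.Disjoint.Propositional using (Disjoint)
open import Data.List.Relation.Unary.Any using (Any; here; there)
import Data.List.Relation.Unary.All as All
open import Data.List.Relation.Unary.AllPairs using ([]; _∷_)
open import Data.List.Relation.Unary.Unique.Propositional using (Unique)
import Data.List.Relation.Unary.Unique.Propositional.Properties as Unique
open import Data.Nat using (ℕ; zero; suc; _+_; _*_; _^_; _∸_; _<_; _≤_; z≤n; s≤s; NonZero)
import Data.Nat as ℕ
open import Data.Nat.DivMod using (_%_; %-distribˡ-+; m%n%n≡m%n; n%n≡0; m<n⇒m%n≡m; m*n%n≡0)
open import Data.Nat.Divisibility using (_∣_; divides)
open import Data.Nat.Properties
  using ( +-identityʳ; *-identityˡ; +-comm; +-commutativeSemigroup; <⇒≤; m+[n∸m]≡n; m+n∸m≡n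
        ; m^n>0; m^n≢0; ^-monoʳ-<; n<1+n; m<n⇒n≢0)
open import Data.Product using (_×_; _,_; proj₁; proj₂; ∃)
import Data.Product.Properties as ProdP
open import Data.Sum using (_⊎_; inj₁; inj₂)
import Data.Sum as Sum
open import Data.Vec using (Vec; []; _∷_; replicate; zipWith)
import Data.Vec as Vec
import Data.Vec.Properties as VecP
open import Function using (id; _∘_)
open import Relation.Binary.Definitions using (DecidableEquality)
open import Relation.Binary.PropositionalEquality using (_≡_; _≢_; refl; sym; trans; cong; cong₂; subst; module ≡-Reasoning)
open import Relation.Nullary using (¬_; Dec; yes; no; does; _×-dec_; _⊎-dec_)
open import Relation.Nullary.Decidable using (True; toWitness; dec-true; dec-false)
import Relation.Nullary.Decidable as Dec
open import Relation.Unary using (Decidable)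

module _ {A : Set} (_≟_ : DecidableEquality A) where

  count : A → List A → ℕ
  count x xs = length (filter (x ≟_) xs)

  count-++ : ∀ x xs ys → count x (xs ++ ys) ≡ count x xs + count x ys
  count-++ x xs ys = trans (cong length (filter-++ (x ≟_) xs ys)) (length-++ (filter (x ≟_) xs))

  count-concatMap-++ : ∀ {B : Set} x (f g : B → List A) bs →
    count x (concatMap (λ b → f b ++ g b) bs) ≡ count x (concatMap f bs) + count x (concatMap g bs)
  count-concatMap-++ x f g [] = refl
  count-concatMap-++ x f g (b ∷ bs) = begin
    count x ((f b ++ g b) ++ concatMap (λ b → f b ++ g b) bs)
      ≡⟨ count-++ x (f b ++ g b) _ ⟩
    count x (f b ++ g b) + count x (concatMap (λ b → f b ++ g b) bs)
      ≡⟨ cong₂ _+_ (count-++ x (f b) (g b)) (count-concatMap-++ x f g bs) ⟩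
    (count x (f b) + count x (g b)) + (count x (concatMap f bs) + count x (concatMap g bs))
      ≡⟨ CommutativeSemigroupProperties.interchange +-commutativeSemigroup
           (count x (f b)) (count x (g b)) (count x (concatMap f bs)) (count x (concatMap g bs)) ⟩
    (count x (f b) + count x (concatMap f bs)) + (count x (g b) + count x (concatMap g bs))
      ≡⟨ sym (cong₂ _+_ (count-++ x (f b) _) (count-++ x (g b) _)) ⟩
    count x (concatMap f (b ∷ bs)) + count x (concatMap g (b ∷ bs)) ∎
    where open ≡-Reasoning

  count-∈ : ∀ {x xs} → x ∈ xs → 0 < count x xs
  count-∈ {x} {y ∷ ys} x∈ with x ≟ y | x∈
  ... | yes _ | _ = s≤s z≤n
  ... | no x≢y | here x≡y = ⊥-elim (x≢y x≡y)
  ... | no _ | there x∈ys = count-∈ x∈ys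

  count-map-∉ : ∀ {B : Set} {f : B → A} x → (∀ b → x ≢ f b) → ∀ bs → count x (map f bs) ≡ 0
  count-map-∉ x x∉ [] = refl
  count-map-∉ {f = f} x x∉ (b ∷ bs) with x ≟ f b
  ... | yes x≡fb = ⊥-elim (x∉ b x≡fb)
  ... | no _ = count-map-∉ x x∉ bs

module _ {A B : Set} (_≟ᴬ_ : DecidableEquality A) (_≟ᴮ_ : DecidableEquality B) {f : A → B} where

  count-map-injective : (∀ {a a′} → f a ≡ f a′ → a ≡ a′) →
    ∀ a as → count _≟ᴮ_ (f a) (map f as) ≡ count _≟ᴬ_ a as
  count-map-injective inj a [] = refl
  count-map-injective inj a (a′ ∷ as) with a ≟ᴬ a′ | f a ≟ᴮ f a′
  ... | yes _ | yes _ = cong suc (count-map-injective inj a as)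
  ... | yes refl | no fa≢fa = ⊥-elim (fa≢fa refl)
  ... | no a≢a′ | yes fa≡fa′ = ⊥-elim (a≢a′ (inj fa≡fa′))
  ... | no _ | no _ = count-map-injective inj a as

∀-by-enumeration : ∀ {A : Set} {P : A → Set} (P? : Decidable P) {xs : List A} →
  (∀ x → x ∈ xs) → True (All.all? P? xs) → ∀ x → P x
∀-by-enumeration P? complete ok x = All.lookup (toWitness ok) (complete x)

module _ (m : ℕ) .{{_ : NonZero m}} where

  toℕ-zeroZ : toℕ (zeroZ m) ≡ 0
  toℕ-zeroZ = trans (FinP.toℕ-fromℕ< _) (m*n%n≡0 0 m)

  toℕ-addZ : ∀ a b → toℕ (addZ m a b) ≡ (toℕ a + toℕ b) % m
  toℕ-addZ a b = FinP.toℕ-fromℕ< _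

  toℕ%m≡toℕ : ∀ a → toℕ a % m ≡ toℕ a
  toℕ%m≡toℕ a = m<n⇒m%n≡m (FinP.toℕ<n a)

  addZ-identityˡ : LeftIdentity _≡_ (zeroZ m) (addZ m)
  addZ-identityˡ a = FinP.toℕ-injective (begin
    toℕ (addZ m (zeroZ m) a)     ≡⟨ toℕ-addZ (zeroZ m) a ⟩
    (toℕ (zeroZ m) + toℕ a) % m  ≡⟨ cong (λ z → (z + toℕ a) % m) toℕ-zeroZ ⟩
    toℕ a % m                    ≡⟨ toℕ%m≡toℕ a ⟩
    toℕ a                        ∎)
    where open ≡-Reasoning

  addZ-identityʳ : RightIdentity _≡_ (zeroZ m) (addZ m)
  addZ-identityʳ a = FinP.toℕ-injective (begin
    toℕ (addZ m a (zeroZ m))     ≡⟨ toℕ-addZ a (zeroZ m) ⟩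
    (toℕ a + toℕ (zeroZ m)) % m  ≡⟨ cong (λ z → (toℕ a + z) % m) toℕ-zeroZ ⟩
    (toℕ a + 0) % m              ≡⟨ cong (_% m) (+-identityʳ (toℕ a)) ⟩
    toℕ a % m                    ≡⟨ toℕ%m≡toℕ a ⟩
    toℕ a                        ∎)
    where open ≡-Reasoning

  addZ-inverseʳ : RightInverse _≡_ (zeroZ m) (negZ m) (addZ m)
  addZ-inverseʳ a = FinP.toℕ-injective (begin
    toℕ (addZ m a (negZ m a))              ≡⟨ toℕ-addZ a (negZ m a) ⟩
    (toℕ a + toℕ (negZ m a)) % m           ≡⟨ cong (λ z → (toℕ a + z) % m) (FinP.toℕ-fromℕ< _) ⟩
    (toℕ a + (m ∸ toℕ a) % m) % m          ≡⟨ %-distribˡ-+ (toℕ a) _ m ⟩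
    (toℕ a % m + (m ∸ toℕ a) % m % m) % m  ≡⟨ cong (λ z → (toℕ a % m + z) % m) (m%n%n≡m%n (m ∸ toℕ a) m) ⟩
    (toℕ a % m + (m ∸ toℕ a) % m) % m      ≡⟨ sym (%-distribˡ-+ (toℕ a) _ m) ⟩
    (toℕ a + (m ∸ toℕ a)) % m              ≡⟨ cong (_% m) (m+[n∸m]≡n (<⇒≤ (FinP.toℕ<n a))) ⟩
    m % m                                  ≡⟨ n%n≡0 m ⟩
    0                                      ≡⟨ sym toℕ-zeroZ ⟩
    toℕ (zeroZ m)                          ∎)
    where open ≡-Reasoning

  negZ-zero : negZ m (zeroZ m) ≡ zeroZ m
  negZ-zero = trans (sym (addZ-identityˡ (negZ m (zeroZ m)))) (addZ-inverseʳ (zeroZ m))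

2^n+2^n≡2^[1+n] : ∀ n → 2 ^ n + 2 ^ n ≡ 2 ^ suc n
2^n+2^n≡2^[1+n] n = cong (2 ^ n +_) (sym (+-identityʳ (2 ^ n)))

module _ (k : ℕ) where

  private instance
    2^[1+k]≢0 : NonZero (2 ^ suc k)
    2^[1+k]≢0 = m^n≢0 2 (suc k)

  2^k<2^[1+k] : 2 ^ k < 2 ^ suc k
  2^k<2^[1+k] = ^-monoʳ-< 2 (s≤s (s≤s z≤n)) (n<1+n k)

  half : ZMod (2 ^ suc k)
  half = fromℕ< 2^k<2^[1+k]

  toℕ-half : toℕ half ≡ 2 ^ k
  toℕ-half = FinP.toℕ-fromℕ< 2^k<2^[1+k]

  half+half≡0 : addZ (2 ^ suc k) half half ≡ zeroZ (2 ^ suc k)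
  half+half≡0 = FinP.toℕ-injective (begin
    toℕ (addZ (2 ^ suc k) half half)   ≡⟨ toℕ-addZ (2 ^ suc k) half half ⟩
    (toℕ half + toℕ half) % 2 ^ suc k  ≡⟨ cong (λ z → (z + z) % 2 ^ suc k) toℕ-half ⟩
    (2 ^ k + 2 ^ k) % 2 ^ suc k        ≡⟨ cong (_% 2 ^ suc k) (2^n+2^n≡2^[1+n] k) ⟩
    2 ^ suc k % 2 ^ suc k              ≡⟨ n%n≡0 (2 ^ suc k) ⟩
    0                                  ≡⟨ sym (toℕ-zeroZ (2 ^ suc k)) ⟩
    toℕ (zeroZ (2 ^ suc k))            ∎)
    where open ≡-Reasoning

  negZ-half : negZ (2 ^ suc k) half ≡ half
  negZ-half = FinP.toℕ-injective (begin
    toℕ (negZ (2 ^ suc k) half)         ≡⟨ FinP.toℕ-fromℕ< _ ⟩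
    (2 ^ suc k ∸ toℕ half) % 2 ^ suc k  ≡⟨ cong (λ z → (2 ^ suc k ∸ z) % 2 ^ suc k) toℕ-half ⟩
    (2 ^ suc k ∸ 2 ^ k) % 2 ^ suc k     ≡⟨ cong (λ z → (z ∸ 2 ^ k) % 2 ^ suc k) (sym (2^n+2^n≡2^[1+n] k)) ⟩
    (2 ^ k + 2 ^ k ∸ 2 ^ k) % 2 ^ suc k ≡⟨ cong (_% 2 ^ suc k) (m+n∸m≡n (2 ^ k) (2 ^ k)) ⟩
    2 ^ k % 2 ^ suc k                   ≡⟨ m<n⇒m%n≡m 2^k<2^[1+k] ⟩
    2 ^ k                               ≡⟨ sym toℕ-half ⟩
    toℕ half                            ∎)
    where open ≡-Reasoning

  half≢0 : half ≢ zeroZ (2 ^ suc k)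
  half≢0 half≡0 = m<n⇒n≢0 (m^n>0 2 k) (begin
    2 ^ k                    ≡⟨ sym toℕ-half ⟩
    toℕ half                 ≡⟨ cong toℕ half≡0 ⟩
    toℕ (zeroZ (2 ^ suc k))  ≡⟨ toℕ-zeroZ (2 ^ suc k) ⟩
    0                        ∎)
    where open ≡-Reasoning

pattern 0₂ = Fin.zero
pattern 1₂ = Fin.suc Fin.zero

negZ₂-id : ∀ (a : Fin 2) → negZ 2 a ≡ a
negZ₂-id 0₂ = refl
negZ₂-id 1₂ = refl

module _ {n : ℕ} where

  zeros : Vec (Fin 2) n
  zeros = replicate n 0₂

  zipWith-addZ₂-identityˡ : ∀ (u : Vec (Fin 2) n) → zipWith (addZ 2) zeros u ≡ u
  zipWith-addZ₂-identityˡ = VecP.zipWith-identityˡ (addZ-identityˡ 2)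

  map-negZ₂-id : ∀ (u : Vec (Fin 2) n) → Vec.map (negZ 2) u ≡ u
  map-negZ₂-id u = trans (VecP.map-cong negZ₂-id u) (VecP.map-id u)

  zipWith-addZ₂-self : ∀ (u : Vec (Fin 2) n) → zipWith (addZ 2) u u ≡ zeros
  zipWith-addZ₂-self u = trans (cong (zipWith (addZ 2) u) (sym (map-negZ₂-id u))) (VecP.zipWith-inverseʳ (addZ-inverseʳ 2) u)

zero? : ∀ {n} (u : Vec (Fin 2) n) → Dec (u ≡ zeros)
zero? [] = yes refl
zero? (0₂ ∷ u) = Dec.map′ (cong (0₂ ∷_)) VecP.∷-injectiveʳ (zero? u)
zero? (1₂ ∷ u) = no λ ()

mutual
  allVecs : ∀ n → List (Vec (Fin 2) n)
  allVecs n = zeros ∷ nonzeroVecs n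

  nonzeroVecs : ∀ n → List (Vec (Fin 2) n)
  nonzeroVecs zero = []
  nonzeroVecs (suc n) = map (0₂ ∷_) (nonzeroVecs n) ++ map (1₂ ∷_) (allVecs n)

mutual
  ∈-allVecs : ∀ {n} (u : Vec (Fin 2) n) → u ∈ allVecs n
  ∈-allVecs u with zero? u
  ... | yes refl = here refl
  ... | no u≢0 = there (∈-nonzeroVecs⁺ u u≢0)

  ∈-nonzeroVecs⁺ : ∀ {n} (u : Vec (Fin 2) n) → u ≢ zeros → u ∈ nonzeroVecs n
  ∈-nonzeroVecs⁺ [] u≢0 = ⊥-elim (u≢0 refl)
  ∈-nonzeroVecs⁺ (0₂ ∷ u) u≢0 = ∈-++⁺ˡ (∈-map⁺ (0₂ ∷_) (∈-nonzeroVecs⁺ u (u≢0 ∘ cong (0₂ ∷_))))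
  ∈-nonzeroVecs⁺ {suc n} (1₂ ∷ u) _ = ∈-++⁺ʳ (map (0₂ ∷_) (nonzeroVecs n)) (∈-map⁺ (1₂ ∷_) (∈-allVecs u))

∈-nonzeroVecs⁻ : ∀ {n} {u : Vec (Fin 2) n} → u ∈ nonzeroVecs n → u ≢ zeros
∈-nonzeroVecs⁻ {suc n} u∈ with ∈-++⁻ (map (0₂ ∷_) (nonzeroVecs n)) u∈
... | inj₁ u∈₀ with ∈-map⁻ (0₂ ∷_) u∈₀
...   | w , w∈ , refl = ∈-nonzeroVecs⁻ w∈ ∘ VecP.∷-injectiveʳ
∈-nonzeroVecs⁻ {suc n} u∈ | inj₂ u∈₁ with ∈-map⁻ (1₂ ∷_) u∈₁
...   | w , _ , refl = λ ()

mutual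
  allVecs-unique : ∀ n → Unique (allVecs n)
  allVecs-unique n = All.tabulate (λ u∈ 0≡u → ∈-nonzeroVecs⁻ u∈ (sym 0≡u)) ∷ nonzeroVecs-unique n

  nonzeroVecs-unique : ∀ n → Unique (nonzeroVecs n)
  nonzeroVecs-unique zero = []
  nonzeroVecs-unique (suc n) =
    Unique.++⁺ (Unique.map⁺ VecP.∷-injectiveʳ (nonzeroVecs-unique n))
               (Unique.map⁺ VecP.∷-injectiveʳ (allVecs-unique n))
               heads-differ
    where
    heads-differ : Disjoint (map (0₂ ∷_) (nonzeroVecs n)) (map (1₂ ∷_) (allVecs n))
    heads-differ (v∈₀ , v∈₁) with ∈-map⁻ (0₂ ∷_) v∈₀ | ∈-map⁻ (1₂ ∷_) v∈₁
    ... | _ , _ , refl | _ , _ , ()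

length-allVecs : ∀ n → length (allVecs n) ≡ 2 ^ n
length-allVecs zero = refl
length-allVecs (suc n) = begin
  suc (length (map (0₂ ∷_) (nonzeroVecs n) ++ map (1₂ ∷_) (allVecs n)))
    ≡⟨ cong suc (length-++ (map (0₂ ∷_) (nonzeroVecs n))) ⟩
  suc (length (map (0₂ ∷_) (nonzeroVecs n)) + length (map (1₂ ∷_) (allVecs n)))
    ≡⟨ cong suc (cong₂ _+_ (length-map (0₂ ∷_) (nonzeroVecs n)) (length-map (1₂ ∷_) (allVecs n))) ⟩
  length (allVecs n) + length (allVecs n)
    ≡⟨ cong₂ _+_ (length-allVecs n) (length-allVecs n) ⟩
  2 ^ n + 2 ^ n
    ≡⟨ 2^n+2^n≡2^[1+n] n ⟩
  2 ^ suc n ∎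
  where open ≡-Reasoning

module PartialSpreads {A : Set} (0# : A) where

  ⟨_⟩ : A → List A
  ⟨ h ⟩ = 0# ∷ h ∷ []

  PairwiseTrivial : List (List A) → Set
  PairwiseTrivial Σs = ∀ (i j : Fin (length Σs)) → i ≢ j → ∀ g → g ∈ lookup Σs i → g ∈ lookup Σs j → g ≡ 0#

  ∈-⟨⟩s⁻ : ∀ {g} hs → Any (g ∈_) (map ⟨_⟩ hs) → g ≡ 0# ⊎ g ∈ hs
  ∈-⟨⟩s⁻ (h ∷ hs) (here (here g≡0)) = inj₁ g≡0
  ∈-⟨⟩s⁻ (h ∷ hs) (here (there (here g≡h))) = inj₂ (here g≡h)
  ∈-⟨⟩s⁻ (h ∷ hs) (there g∈) = Sum.map₂ there (∈-⟨⟩s⁻ hs g∈)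

  ∈-⟨⟩s⁺ : ∀ {g hs} → g ∈ hs → Any (g ∈_) (map ⟨_⟩ hs)
  ∈-⟨⟩s⁺ (here refl) = here (there (here refl))
  ∈-⟨⟩s⁺ (there g∈) = there (∈-⟨⟩s⁺ g∈)

  pairwiseTrivial-∷ : ∀ {S Σs} → PairwiseTrivial Σs →
    (∀ g → g ∈ S → Any (g ∈_) Σs → g ≡ 0#) → PairwiseTrivial (S ∷ Σs)
  pairwiseTrivial-∷ _ _ Fin.zero Fin.zero 0≢0 = ⊥-elim (0≢0 refl)
  pairwiseTrivial-∷ _ S∩Σs Fin.zero (Fin.suc j) _ g g∈S g∈Σⱼ = S∩Σs g g∈S (lose (∈-lookup j) g∈Σⱼ)
  pairwiseTrivial-∷ _ S∩Σs (Fin.suc i) Fin.zero _ g g∈Σᵢ g∈S = S∩Σs g g∈S (lose (∈-lookup i) g∈Σᵢ)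
  pairwiseTrivial-∷ pt _ (Fin.suc i) (Fin.suc j) i≢j = pt i j (i≢j ∘ cong Fin.suc)

  pairwiseTrivial-⟨⟩s : ∀ {hs} → Unique hs → PairwiseTrivial (map ⟨_⟩ hs)
  pairwiseTrivial-⟨⟩s {[]} [] ()
  pairwiseTrivial-⟨⟩s {h ∷ hs} (h∉hs ∷ hs-unique) = pairwiseTrivial-∷ (pairwiseTrivial-⟨⟩s hs-unique) ⟨h⟩∩⟨hs⟩
    where
    ⟨h⟩∩⟨hs⟩ : ∀ g → g ∈ ⟨ h ⟩ → Any (g ∈_) (map ⟨_⟩ hs) → g ≡ 0#
    ⟨h⟩∩⟨hs⟩ g (here g≡0) _ = g≡0
    ⟨h⟩∩⟨hs⟩ g (there (here refl)) g∈ with ∈-⟨⟩s⁻ hs g∈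
    ... | inj₁ g≡0 = g≡0
    ... | inj₂ h∈hs = ⊥-elim (All.lookup h∉hs h∈hs refl)

  length-filter₂-⟨⟩s : ∀ hs → length (filter (λ S → length S ℕ.≟ 2) (map ⟨_⟩ hs)) ≡ length hs
  length-filter₂-⟨⟩s [] = refl
  length-filter₂-⟨⟩s (h ∷ hs) = cong suc (length-filter₂-⟨⟩s hs)

  length-filter₃-⟨⟩s : ∀ hs → length (filter (λ S → length S ℕ.≟ 3) (map ⟨_⟩ hs)) ≡ 0
  length-filter₃-⟨⟩s [] = refl
  length-filter₃-⟨⟩s (h ∷ hs) = length-filter₃-⟨⟩s hs

module GroupLaws (x y : ℕ) where
  open Grp x y hiding (count)
  open PartialSpreads 0G

  +G-identityˡ : ∀ g → 0G +G g ≡ g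
  +G-identityˡ (u , s , t) = cong₂ _,_ (zipWith-addZ₂-identityˡ u) (cong₂ _,_ (addZ-identityˡ (2 ^ y) s) (addZ-identityˡ 3 t))

  +G-identityʳ : ∀ g → g +G 0G ≡ g
  +G-identityʳ (u , s , t) =
    cong₂ _,_ (VecP.zipWith-identityʳ (addZ-identityʳ 2) u) (cong₂ _,_ (addZ-identityʳ (2 ^ y) s) (addZ-identityʳ 3 t))

  -G-zero : -G 0G ≡ 0G
  -G-zero = cong₂ _,_ (map-negZ₂-id zeros) (cong₂ _,_ (negZ-zero (2 ^ y)) (negZ-zero 3))

  -G-self : ∀ g → g -G g ≡ 0G
  -G-self (u , s , t) =
    cong₂ _,_ (VecP.zipWith-inverseʳ (addZ-inverseʳ 2) u) (cong₂ _,_ (addZ-inverseʳ (2 ^ y) s) (addZ-inverseʳ 3 t))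

  ⟨⟩-isSubgroup : ∀ h → h ≢ 0G → h +G h ≡ 0G → -G h ≡ h → IsSubgroup ⟨ h ⟩
  ⟨⟩-isSubgroup h h≢0 h+h≡0 -h≡h = ((h≢0 ∘ sym) All.∷ All.[]) ∷ All.[] ∷ [] , here refl , closed , -closed
    where
    elements : ∀ {g} → g ∈ ⟨ h ⟩ → g ≡ 0G ⊎ g ≡ h
    elements (here g≡0) = inj₁ g≡0
    elements (there (here g≡h)) = inj₂ g≡h

    closed : ∀ a b → a ∈ ⟨ h ⟩ → b ∈ ⟨ h ⟩ → (a +G b) ∈ ⟨ h ⟩
    closed a b a∈ b∈ with elements a∈ | elements b∈
    ... | inj₁ refl | inj₁ refl = here (+G-identityˡ 0G)
    ... | inj₁ refl | inj₂ refl = there (here (+G-identityˡ h))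
    ... | inj₂ refl | inj₁ refl = there (here (+G-identityʳ h))
    ... | inj₂ refl | inj₂ refl = here h+h≡0

    -closed : ∀ a → a ∈ ⟨ h ⟩ → (-G a) ∈ ⟨ h ⟩
    -closed a a∈ with elements a∈
    ... | inj₁ refl = here -G-zero
    ... | inj₂ refl = there (here -h≡h)

  distinct-if-0∉ΔT : ∀ Ts → count _≟G_ 0G (ΔT Ts) ≡ 0 → ∀ T → T ∈ Ts → Distinct T
  distinct-if-0∉ΔT Ts 0∉ΔT (a , b , c) T∈ =
      (λ a≡b → nonzero (here refl) (trans (cong (λ z → z -G b) a≡b) (-G-self b)))
    , (λ a≡c → nonzero (there (there (here refl))) (trans (cong (λ z → z -G c) a≡c) (-G-self c)))
    , (λ b≡c → nonzero (there (there (there (there (here refl))))) (trans (cong (λ z → z -G c) b≡c) (-G-self c)))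
    where
    nonzero : ∀ {d} → d ∈ Δ (a , b , c) → d ≢ 0G
    nonzero d∈ refl with subst (0 <_) 0∉ΔT (count-∈ _≟G_ (∈-concatMap⁺ Δ (lose T∈ d∈)))
    ... | ()

pattern 0F = Fin.zero
pattern 1F = Fin.suc Fin.zero
pattern 2F = Fin.suc (Fin.suc Fin.zero)

-- (a , b) encodes a + bω ∈ 𝔽₄ = 𝔽₂[ω]/(ω² + ω + 1); ω* is multiplication by ω.
Prefix : Set
Prefix = Fin 2 × Fin 2

_≟ᵖ_ : DecidableEquality Prefix
_≟ᵖ_ = ProdP.≡-dec FinP._≟_ FinP._≟_

prefixes : List Prefix
prefixes = (0₂ , 0₂) ∷ (1₂ , 0₂) ∷ (0₂ , 1₂) ∷ (1₂ , 1₂) ∷ []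

ω* : Prefix → Prefix
ω* (a , b) = b , addZ 2 a b

ω^ : Fin 3 → Prefix → Prefix
ω^ 0F = id
ω^ 1F = ω*
ω^ 2F = ω* ∘ ω*

ω^-permutes : ∀ i e → count _≟ᵖ_ e (map (ω^ i) prefixes) ≡ 1
ω^-permutes 0F (0₂ , 0₂) = refl
ω^-permutes 0F (0₂ , 1₂) = refl
ω^-permutes 0F (1₂ , 0₂) = refl
ω^-permutes 0F (1₂ , 1₂) = refl
ω^-permutes 1F (0₂ , 0₂) = refl
ω^-permutes 1F (0₂ , 1₂) = refl
ω^-permutes 1F (1₂ , 0₂) = refl
ω^-permutes 1F (1₂ , 1₂) = refl
ω^-permutes 2F (0₂ , 0₂) = refl
ω^-permutes 2F (0₂ , 1₂) = refl
ω^-permutes 2F (1₂ , 0₂) = refl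
ω^-permutes 2F (1₂ , 1₂) = refl

Tail : ℕ → Set
Tail y = ZMod (2 ^ y) × ZMod 3

module Doubling (y : ℕ) (m₀ m₁ : Tail y → ℕ) where

  -- Defs indexes the group by x = n + 1, so Elem n = ℤ₂ⁿ × Tail y.
  Elem : ℕ → Set
  Elem n = G (suc n) y

  module _ {n : ℕ} where
    open Grp (suc n) y public using (0G; _-G_; _≟G_; Triple; Δ; ΔT)

  Pair : ℕ → Set
  Pair n = Elem n × Elem n

  mult : ∀ {n} → Elem n → List (Elem n) → ℕ
  mult = count _≟G_

  target : ∀ {n} → Elem n → ℕ
  target (u , t) = if does (zero? u) then m₀ t else m₁ t

  Uniform : ∀ {n} → List (Elem n) → Set
  Uniform L = ∀ g → mult g L ≡ m₁ (proj₂ g)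

  block : ∀ {n} → Pair n → Triple {n}
  block (a , b) = 0G , a , b

  ±diff : ∀ {n} → Fin 3 → Pair n → List (Elem n)
  ±diff 0F (a , b) = 0G -G a ∷ a -G 0G ∷ []
  ±diff 1F (a , b) = 0G -G b ∷ b -G 0G ∷ []
  ±diff 2F (a , b) = a -G b ∷ b -G a ∷ []

  diffs : ∀ {n} → Fin 3 → List (Pair n) → List (Elem n)
  diffs i = concatMap (±diff i)

  mult-ΔT-blocks : ∀ {n} (g : Elem n) S →
    mult g (ΔT (map block S)) ≡ mult g (diffs 0F S) + (mult g (diffs 1F S) + mult g (diffs 2F S))
  mult-ΔT-blocks g S = begin
    mult g (ΔT (map block S))
      ≡⟨ cong (mult g) (concatMap-map Δ block S) ⟩
    mult g (concatMap (λ p → ±diff 0F p ++ (±diff 1F p ++ ±diff 2F p)) S)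
      ≡⟨ count-concatMap-++ _≟G_ g (±diff 0F) _ S ⟩
    mult g (diffs 0F S) + mult g (concatMap (λ p → ±diff 1F p ++ ±diff 2F p) S)
      ≡⟨ cong (mult g (diffs 0F S) +_) (count-concatMap-++ _≟G_ g (±diff 1F) (±diff 2F) S) ⟩
    mult g (diffs 0F S) + (mult g (diffs 1F S) + mult g (diffs 2F S)) ∎
    where open ≡-Reasoning

  record Stage (n : ℕ) : Set where
    field
      starters : List (Pair n)
      pairs : List (Pair n)
      starters-target : ∀ g → mult g (ΔT (map block starters)) ≡ target g
      pairs-uniform : ∀ i → Uniform (diffs i pairs)

  lift : ∀ {n} → Prefix → Elem n → Elem (suc (suc n))
  lift (a , b) (u , t) = a ∷ b ∷ u , t

  liftPair : ∀ {n} → Prefix → Pair n → Pair (suc (suc n))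
  liftPair w (a , b) = lift w a , lift (ω* w) b

  -- lift commutes with subtraction, and in 𝔽₄ we have 0 − w = w − 0 = w and w − ωw = ωw − w = ω²w.
  ±diff-liftPair : ∀ {n} i w (p : Pair n) → ±diff i (liftPair w p) ≡ map (lift (ω^ i w)) (±diff i p)
  ±diff-liftPair 0F (0₂ , 0₂) p = refl
  ±diff-liftPair 0F (0₂ , 1₂) p = refl
  ±diff-liftPair 0F (1₂ , 0₂) p = refl
  ±diff-liftPair 0F (1₂ , 1₂) p = refl
  ±diff-liftPair 1F (0₂ , 0₂) p = refl
  ±diff-liftPair 1F (0₂ , 1₂) p = refl
  ±diff-liftPair 1F (1₂ , 0₂) p = refl
  ±diff-liftPair 1F (1₂ , 1₂) p = refl
  ±diff-liftPair 2F (0₂ , 0₂) p = refl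
  ±diff-liftPair 2F (0₂ , 1₂) p = refl
  ±diff-liftPair 2F (1₂ , 0₂) p = refl
  ±diff-liftPair 2F (1₂ , 1₂) p = refl

  diffs-liftPair : ∀ {n} i w (X : List (Pair n)) → diffs i (map (liftPair w) X) ≡ map (lift (ω^ i w)) (diffs i X)
  diffs-liftPair i w X = begin
    concatMap (±diff i) (map (liftPair w) X)     ≡⟨ concatMap-map (±diff i) (liftPair w) X ⟩
    concatMap (±diff i ∘ liftPair w) X           ≡⟨ concatMap-cong (±diff-liftPair i w) X ⟩
    concatMap (map (lift (ω^ i w)) ∘ ±diff i) X  ≡⟨ sym (map-concatMap (lift (ω^ i w)) (±diff i) X) ⟩
    map (lift (ω^ i w)) (concatMap (±diff i) X)  ∎
    where open ≡-Reasoning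

  diffs-concatMap-liftPair : ∀ {n} i (X : List (Pair n)) ws →
    diffs i (concatMap (λ w → map (liftPair w) X) ws) ≡ concatMap (λ w → map (lift w) (diffs i X)) (map (ω^ i) ws)
  diffs-concatMap-liftPair i X [] = refl
  diffs-concatMap-liftPair i X (w ∷ ws) =
    trans (concatMap-++ (±diff i) (map (liftPair w) X) _) (cong₂ _++_ (diffs-liftPair i w X) (diffs-concatMap-liftPair i X ws))

  mult-map-lift : ∀ {n} e w (v : Elem n) X → mult (lift e v) (map (lift w) X) ≡ (if does (e ≟ᵖ w) then mult v X else 0)
  mult-map-lift e w v X with e ≟ᵖ w
  ... | yes refl = count-map-injective _≟G_ _≟G_ lift-injective v X
    where
    lift-injective : ∀ {a a′} → lift e a ≡ lift e a′ → a ≡ a′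
    lift-injective refl = refl
  ... | no e≢w = count-map-∉ _≟G_ (lift e v) other-prefix X
    where
    other-prefix : ∀ a → lift e v ≢ lift w a
    other-prefix a refl = e≢w refl

  mult-concatMap-lift : ∀ {n} e (v : Elem n) X ws →
    mult (lift e v) (concatMap (λ w → map (lift w) X) ws) ≡ count _≟ᵖ_ e ws * mult v X
  mult-concatMap-lift e v X [] = refl
  mult-concatMap-lift e v X (w ∷ ws)
    rewrite count-++ _≟G_ (lift e v) (map (lift w) X) (concatMap (λ w → map (lift w) X) ws)
          | mult-map-lift e w v X | mult-concatMap-lift e v X ws
    with does (e ≟ᵖ w)
  ... | true = refl
  ... | false = refl

  double : ∀ {n} → Stage n → Stage (suc (suc n))
  double {n} s = record
    { starters = starters′
    ; pairs = pairs′
    ; starters-target = λ { (e₁ ∷ e₂ ∷ u , t) → starters′-target u t (e₁ , e₂) }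
    ; pairs-uniform = λ { i (e₁ ∷ e₂ ∷ u , t) → pairs′-uniform i (e₁ , e₂) (u , t) }
    }
    where
    open Stage s
    open ≡-Reasoning

    starters′ pairs′ : List (Pair (suc (suc n)))
    starters′ = map (liftPair (0₂ , 0₂)) starters ++ map (liftPair (1₂ , 0₂)) pairs
    pairs′ = concatMap (λ w → map (liftPair w) pairs) prefixes

    pairs′-uniform : ∀ i e v → mult (lift e v) (diffs i pairs′) ≡ m₁ (proj₂ v)
    pairs′-uniform i e v = begin
      mult (lift e v) (diffs i pairs′)
        ≡⟨ cong (mult (lift e v)) (diffs-concatMap-liftPair i pairs prefixes) ⟩
      mult (lift e v) (concatMap (λ w → map (lift w) (diffs i pairs)) (map (ω^ i) prefixes))
        ≡⟨ mult-concatMap-lift e v (diffs i pairs) (map (ω^ i) prefixes) ⟩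
      count _≟ᵖ_ e (map (ω^ i) prefixes) * mult v (diffs i pairs)
        ≡⟨ cong₂ _*_ (ω^-permutes i e) (pairs-uniform i v) ⟩
      1 * m₁ (proj₂ v)
        ≡⟨ *-identityˡ (m₁ (proj₂ v)) ⟩
      m₁ (proj₂ v) ∎

    module _ (u : Vec (Fin 2) n) (t : Tail y) where
      v : Elem n
      v = u , t

      contribution : Prefix → Fin 3 → ℕ
      contribution e i = (if does (e ≟ᵖ ω^ i (0₂ , 0₂)) then mult v (diffs i starters) else 0)
                       + (if does (e ≟ᵖ ω^ i (1₂ , 0₂)) then mult v (diffs i pairs) else 0)

      mult-diffs-starters′ : ∀ e i → mult (lift e v) (diffs i starters′) ≡ contribution e i
      mult-diffs-starters′ e i = begin
        mult (lift e v) (diffs i starters′)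
          ≡⟨ cong (mult (lift e v)) (concatMap-++ (±diff i) (map (liftPair (0₂ , 0₂)) starters) _) ⟩
        mult (lift e v) (diffs i (map (liftPair (0₂ , 0₂)) starters) ++ diffs i (map (liftPair (1₂ , 0₂)) pairs))
          ≡⟨ count-++ _≟G_ (lift e v) (diffs i (map (liftPair (0₂ , 0₂)) starters)) _ ⟩
        mult (lift e v) (diffs i (map (liftPair (0₂ , 0₂)) starters)) + mult (lift e v) (diffs i (map (liftPair (1₂ , 0₂)) pairs))
          ≡⟨ cong₂ _+_ (lifted starters (0₂ , 0₂)) (lifted pairs (1₂ , 0₂)) ⟩
        contribution e i ∎
        where
        lifted : ∀ X w → mult (lift e v) (diffs i (map (liftPair w) X)) ≡ (if does (e ≟ᵖ ω^ i w) then mult v (diffs i X) else 0)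
        lifted X w = trans (cong (mult (lift e v)) (diffs-liftPair i w X)) (mult-map-lift e (ω^ i w) v (diffs i X))

      tally : ∀ e → contribution e 0F + (contribution e 1F + contribution e 2F) ≡ target (lift e v)
      tally (0₂ , 0₂) = begin
        (c 0F + 0) + ((c 1F + 0) + (c 2F + 0))
          ≡⟨ cong₂ _+_ (+-identityʳ (c 0F)) (cong₂ _+_ (+-identityʳ (c 1F)) (+-identityʳ (c 2F))) ⟩
        c 0F + (c 1F + c 2F)
          ≡⟨ sym (mult-ΔT-blocks v starters) ⟩
        mult v (ΔT (map block starters))
          ≡⟨ starters-target v ⟩
        target v ∎
        where
        c : Fin 3 → ℕ
        c i = mult v (diffs i starters)
      tally (1₂ , 0₂) = trans (+-identityʳ _) (pairs-uniform 0F v)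
      tally (0₂ , 1₂) = trans (+-identityʳ _) (pairs-uniform 1F v)
      tally (1₂ , 1₂) = pairs-uniform 2F v

      starters′-target : ∀ e → mult (lift e v) (ΔT (map block starters′)) ≡ target (lift e v)
      starters′-target e = begin
        mult (lift e v) (ΔT (map block starters′))
          ≡⟨ mult-ΔT-blocks (lift e v) starters′ ⟩
        m 0F + (m 1F + m 2F)
          ≡⟨ cong₂ _+_ (mult-diffs-starters′ e 0F) (cong₂ _+_ (mult-diffs-starters′ e 1F) (mult-diffs-starters′ e 2F)) ⟩
        contribution e 0F + (contribution e 1F + contribution e 2F)
          ≡⟨ tally e ⟩
        target (lift e v) ∎
        where
        m : Fin 3 → ℕ
        m i = mult (lift e v) (diffs i starters′)


  iterate : ∀ {n} → Stage n → ∀ m → Stage (m * 2 + n)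
  iterate s zero = s
  iterate s (suc m) = double (iterate s m)

  elements : ∀ {n} → List (Elem n)
  elements {n} = cartesianProduct (allVecs n) (cartesianProduct (allFin (2 ^ y)) (allFin 3))

  ∈-elements : ∀ {n} (g : Elem n) → g ∈ elements
  ∈-elements (u , s , t) = ∈-cartesianProduct⁺ (∈-allVecs u) (∈-cartesianProduct⁺ (∈-allFin s) (∈-allFin t))

  agrees? : ∀ {n} (L : List (Elem n)) (f : Elem n → ℕ) → Decidable (λ g → mult g L ≡ f g)
  agrees? L f g = mult g L ℕ.≟ f g

  stageByComputation : ∀ {n} (S P : List (Pair n))
    → {True (All.all? (agrees? (ΔT (map block S)) target) elements)}
    → {True (All.all? (agrees? (diffs 0F P) (m₁ ∘ proj₂)) elements)}
    → {True (All.all? (agrees? (diffs 1F P) (m₁ ∘ proj₂)) elements)}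
    → {True (All.all? (agrees? (diffs 2F P) (m₁ ∘ proj₂)) elements)}
    → Stage n
  stageByComputation S P {okS} {ok₀} {ok₁} {ok₂} = record
    { starters = S
    ; pairs = P
    ; starters-target = ∀-by-enumeration (agrees? (ΔT (map block S)) target) ∈-elements okS
    ; pairs-uniform = λ
        { 0F → ∀-by-enumeration (agrees? (diffs 0F P) (m₁ ∘ proj₂)) ∈-elements ok₀
        ; 1F → ∀-by-enumeration (agrees? (diffs 1F P) (m₁ ∘ proj₂)) ∈-elements ok₁
        ; 2F → ∀-by-enumeration (agrees? (diffs 2F P) (m₁ ∘ proj₂)) ∈-elements ok₂
        }
    }

module Construction (k : ℕ) where
  private instance
    2^[1+k]≢0 : NonZero (2 ^ suc k)
    2^[1+k]≢0 = m^n≢0 2 (suc k)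

  0ˢ : ZMod (2 ^ suc k)
  0ˢ = zeroZ (2 ^ suc k)

  TailCovered : Tail (suc k) → Set
  TailCovered (s , t) = t ≡ 0F × (s ≡ 0ˢ ⊎ s ≡ half k)

  tailCovered? : Decidable TailCovered
  tailCovered? (s , t) = (t FinP.≟ 0F) ×-dec (s FinP.≟ 0ˢ ⊎-dec s FinP.≟ half k)

  centralMultiplicity outerMultiplicity : Tail (suc k) → ℕ
  centralMultiplicity (s , t) = if does (s FinP.≟ 0ˢ ⊎-dec tailCovered? (s , t)) then 0 else 1
  outerMultiplicity t = if does (tailCovered? t) then 0 else 1

  open Doubling (suc k) centralMultiplicity outerMultiplicity public

  module Spread (N : ℕ) where
    open Grp (suc N) (suc k) hiding (count; 0G; _-G_; _≟G_; Triple; Δ; ΔT)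
    open GroupLaws (suc N) (suc k)
    open PartialSpreads (0G {N})

    Covered : G (suc N) (suc k) → Set
    Covered (u , s , t) = (u ≡ zeros × s ≡ 0ˢ) ⊎ TailCovered (s , t)

    covered? : Decidable Covered
    covered? (u , s , t) = (zero? u ×-dec s FinP.≟ 0ˢ) ⊎-dec tailCovered? (s , t)

    target-indicator : ∀ g → target g ≡ (if does (covered? g) then 0 else 1)
    target-indicator (u , _) with does (zero? u)
    ... | true = refl
    ... | false = refl

    target-covered : ∀ {g} → Covered g → target g ≡ 0
    target-covered {g} c = trans (target-indicator g) (cong (if_then 0 else 1) (dec-true (covered? g) c))

    target-uncovered : ∀ {g} → ¬ Covered g → target g ≡ 1
    target-uncovered {g} ¬c = trans (target-indicator g) (cong (if_then 0 else 1) (dec-false (covered? g) ¬c))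

    -- The elements of order at most 2 form ℤ₂^N × {0, half} × {0} ≅ ℤ₂^(N+1).
    involution : Vec (Fin 2) (suc N) → G (suc N) (suc k)
    involution (0₂ ∷ u) = u , 0ˢ , 0F
    involution (1₂ ∷ u) = u , half k , 0F

    involution-injective : ∀ {w w′} → involution w ≡ involution w′ → w ≡ w′
    involution-injective {0₂ ∷ _} {0₂ ∷ _} refl = refl
    involution-injective {0₂ ∷ _} {1₂ ∷ _} eq = ⊥-elim (half≢0 k (sym (cong (proj₁ ∘ proj₂) eq)))
    involution-injective {1₂ ∷ _} {0₂ ∷ _} eq = ⊥-elim (half≢0 k (cong (proj₁ ∘ proj₂) eq))
    involution-injective {1₂ ∷ _} {1₂ ∷ _} refl = refl

    involution-nonzero : ∀ {w} → w ∈ nonzeroVecs (suc N) → involution w ≢ 0G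
    involution-nonzero w∈ eq = ∈-nonzeroVecs⁻ w∈ (involution-injective eq)

    involution-covered : ∀ w → Covered (involution w)
    involution-covered (0₂ ∷ _) = inj₂ (refl , inj₁ refl)
    involution-covered (1₂ ∷ _) = inj₂ (refl , inj₂ refl)

    involution+involution : ∀ w → involution w +G involution w ≡ 0G
    involution+involution (0₂ ∷ u) = cong₂ _,_ (zipWith-addZ₂-self u) (cong₂ _,_ (addZ-identityˡ (2 ^ suc k) 0ˢ) refl)
    involution+involution (1₂ ∷ u) = cong₂ _,_ (zipWith-addZ₂-self u) (cong₂ _,_ (half+half≡0 k) refl)

    -involution : ∀ w → -G involution w ≡ involution w
    -involution (0₂ ∷ u) = cong₂ _,_ (map-negZ₂-id u) (cong₂ _,_ (negZ-zero (2 ^ suc k)) refl)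
    -involution (1₂ ∷ u) = cong₂ _,_ (map-negZ₂-id u) (cong₂ _,_ (negZ-half k) refl)

    involutions : List (G (suc N) (suc k))
    involutions = map involution (nonzeroVecs (suc N))

    central : ZMod 3 → G (suc N) (suc k)
    central t = zeros , 0ˢ , t

    C₃ : List (G (suc N) (suc k))
    C₃ = map central (allFin 3)

    spread : List (List (G (suc N) (suc k)))
    spread = C₃ ∷ map ⟨_⟩ involutions

    ∈-C₃⁺ : ∀ t → central t ∈ C₃
    ∈-C₃⁺ t = ∈-map⁺ central (∈-allFin t)

    ∈-C₃⁻ : ∀ {g} → g ∈ C₃ → ∃ λ t → g ≡ central t
    ∈-C₃⁻ g∈ with ∈-map⁻ central g∈
    ... | t , _ , g≡ = t , g≡

    central+central : ∀ t t′ → central t +G central t′ ≡ central (addZ 3 t t′)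
    central+central t t′ = cong₂ _,_ (zipWith-addZ₂-identityˡ zeros) (cong₂ _,_ (addZ-identityˡ (2 ^ suc k) 0ˢ) refl)

    -central : ∀ t → -G central t ≡ central (negZ 3 t)
    -central t = cong₂ _,_ (map-negZ₂-id zeros) (cong₂ _,_ (negZ-zero (2 ^ suc k)) refl)

    C₃-isSubgroup : IsSubgroup C₃
    C₃-isSubgroup = Unique.map⁺ {f = central} (cong (proj₂ ∘ proj₂)) (Unique.allFin⁺ 3) , here refl , closed , -closed
      where
      closed : ∀ a b → a ∈ C₃ → b ∈ C₃ → (a +G b) ∈ C₃
      closed a b a∈ b∈ with ∈-C₃⁻ a∈ | ∈-C₃⁻ b∈
      ... | t , refl | t′ , refl = subst (_∈ C₃) (sym (central+central t t′)) (∈-C₃⁺ (addZ 3 t t′))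
      -closed : ∀ a → a ∈ C₃ → (-G a) ∈ C₃
      -closed a a∈ with ∈-C₃⁻ a∈
      ... | t , refl = subst (_∈ C₃) (sym (-central t)) (∈-C₃⁺ (negZ 3 t))

    spread-subgroups : ∀ S → S ∈ spread → IsSubgroup S
    spread-subgroups _ (here refl) = C₃-isSubgroup
    spread-subgroups _ (there S∈) with ∈-map⁻ ⟨_⟩ S∈
    ... | h , h∈ , refl with ∈-map⁻ involution h∈
    ...   | w , w∈ , refl = ⟨⟩-isSubgroup (involution w) (involution-nonzero w∈) (involution+involution w) (-involution w)

    C₃∩involutions : ∀ g → g ∈ C₃ → Any (g ∈_) (map ⟨_⟩ involutions) → g ≡ 0G
    C₃∩involutions g g∈ g∈′ with ∈-C₃⁻ g∈ | ∈-⟨⟩s⁻ involutions g∈′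
    ... | _ | inj₁ g≡0 = g≡0
    ... | t , refl | inj₂ g∈inv with ∈-map⁻ involution g∈inv
    ...   | 0₂ ∷ _ , _ , eq = cong central (cong (proj₂ ∘ proj₂) eq)
    ...   | 1₂ ∷ _ , _ , eq = cong central (cong (proj₂ ∘ proj₂) eq)

    spread-pairwiseTrivial : PairwiseTrivial spread
    spread-pairwiseTrivial =
      pairwiseTrivial-∷ (pairwiseTrivial-⟨⟩s (Unique.map⁺ involution-injective (nonzeroVecs-unique (suc N)))) C₃∩involutions

    spread-orders : ∀ S → S ∈ spread → length S ≡ 2 ⊎ length S ≡ 3
    spread-orders _ (here refl) = inj₂ refl
    spread-orders _ (there S∈) with ∈-map⁻ ⟨_⟩ S∈
    ... | _ , _ , refl = inj₁ refl

    spread-count₂ : numOfOrder 2 spread ≡ 2 ^ suc N ∸ 1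
    spread-count₂ = begin
      length (filter (λ S → length S ℕ.≟ 2) (map ⟨_⟩ involutions))  ≡⟨ length-filter₂-⟨⟩s involutions ⟩
      length involutions                                           ≡⟨ length-map involution (nonzeroVecs (suc N)) ⟩
      length (nonzeroVecs (suc N))                                 ≡⟨ cong (_∸ 1) (length-allVecs (suc N)) ⟩
      2 ^ suc N ∸ 1                                                ∎
      where open ≡-Reasoning

    spread-count₃ : numOfOrder 3 spread ≡ 1
    spread-count₃ = cong suc (length-filter₃-⟨⟩s involutions)

    involution∈spread : ∀ w → Any (involution w ∈_) spread
    involution∈spread w with zero? w
    ... | yes refl = here (∈-C₃⁺ 0F)
    ... | no w≢0 = there (∈-⟨⟩s⁺ (∈-map⁺ involution (∈-nonzeroVecs⁺ w w≢0)))

    covered⇒∈spread : ∀ g → Covered g → Any (g ∈_) spread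
    covered⇒∈spread (u , s , t) (inj₁ (refl , refl)) = here (∈-C₃⁺ t)
    covered⇒∈spread (u , s , t) (inj₂ (refl , inj₁ refl)) = involution∈spread (0₂ ∷ u)
    covered⇒∈spread (u , s , t) (inj₂ (refl , inj₂ refl)) = involution∈spread (1₂ ∷ u)

    ∈spread⇒covered : ∀ g → Any (g ∈_) spread → Covered g
    ∈spread⇒covered g (here g∈) with ∈-C₃⁻ g∈
    ... | t , refl = inj₁ (refl , refl)
    ∈spread⇒covered g (there g∈) with ∈-⟨⟩s⁻ involutions g∈
    ... | inj₁ refl = inj₁ (refl , refl)
    ... | inj₂ g∈inv with ∈-map⁻ involution g∈inv
    ...   | w , _ , refl = involution-covered w

    differenceFamily : Stage N → DFExists
    differenceFamily s =
        spread , map block starters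
      , (spread-subgroups , spread-pairwiseTrivial)
      , (spread-orders , spread-count₂ , spread-count₃)
      , distinct-if-0∉ΔT (map block starters) (trans (starters-target 0G) (target-covered {0G} (inj₁ (refl , refl))))
      , λ g → (λ g∈ → trans (starters-target g) (target-covered (∈spread⇒covered g g∈)))
            , (λ g∉ → trans (starters-target g) (target-uncovered (g∉ ∘ covered⇒∈spread g)))
      where open Stage s

DFExists-from-stage : ∀ k n → Construction.Stage k n → ∀ m → Grp.DFExists (suc (m * 2 + n)) (suc k)
DFExists-from-stage k n s m = Construction.Spread.differenceFamily k (m * 2 + n) (Construction.iterate k s m)

module BaseStages where
  open import Agda.Builtin.FromNat using (Number; fromNat)
  import Data.Fin.Literals as Fin
  import Data.Nat.Literals as ℕ
  open import Data.Unit using (⊤; tt)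

  private instance
    natLiterals : Number ℕ
    natLiterals = ℕ.number
    finLiterals : ∀ {n} → Number (Fin n)
    finLiterals {n} = Fin.number n
    trivial : ⊤
    trivial = tt

  stage₁ : Construction.Stage 0 1
  stage₁ = Construction.stageByComputation 0
    ( ((0 ∷ [] , 1 , 1) , (1 ∷ [] , 1 , 2))
    ∷ [])
    ( ((0 ∷ [] , 1 , 1) , (1 ∷ [] , 0 , 2))
    ∷ ((1 ∷ [] , 0 , 1) , (0 ∷ [] , 0 , 2))
    ∷ ((1 ∷ [] , 1 , 1) , (1 ∷ [] , 1 , 2))
    ∷ ((0 ∷ [] , 0 , 1) , (0 ∷ [] , 1 , 2))
    ∷ [])

  stage₃ : Construction.Stage 1 3
  stage₃ = Construction.stageByComputation 1
    ( ((0 ∷ 0 ∷ 0 ∷ [] , 1 , 0) , (1 ∷ 0 ∷ 1 ∷ [] , 0 , 1))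
    ∷ ((0 ∷ 0 ∷ 0 ∷ [] , 1 , 1) , (0 ∷ 0 ∷ 1 ∷ [] , 2 , 1))
    ∷ ((0 ∷ 0 ∷ 0 ∷ [] , 1 , 2) , (0 ∷ 1 ∷ 1 ∷ [] , 2 , 2))
    ∷ ((0 ∷ 0 ∷ 0 ∷ [] , 2 , 1) , (1 ∷ 1 ∷ 0 ∷ [] , 1 , 0))
    ∷ ((0 ∷ 0 ∷ 1 ∷ [] , 0 , 1) , (0 ∷ 1 ∷ 1 ∷ [] , 3 , 2))
    ∷ ((0 ∷ 0 ∷ 1 ∷ [] , 1 , 1) , (1 ∷ 0 ∷ 0 ∷ [] , 3 , 2))
    ∷ ((0 ∷ 0 ∷ 1 ∷ [] , 1 , 2) , (1 ∷ 1 ∷ 1 ∷ [] , 3 , 1))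
    ∷ ((0 ∷ 1 ∷ 0 ∷ [] , 0 , 1) , (1 ∷ 0 ∷ 0 ∷ [] , 0 , 2))
    ∷ ((0 ∷ 1 ∷ 0 ∷ [] , 1 , 0) , (1 ∷ 1 ∷ 1 ∷ [] , 2 , 1))
    ∷ ((0 ∷ 1 ∷ 0 ∷ [] , 1 , 1) , (1 ∷ 1 ∷ 1 ∷ [] , 0 , 1))
    ∷ ((0 ∷ 1 ∷ 0 ∷ [] , 2 , 1) , (1 ∷ 1 ∷ 0 ∷ [] , 1 , 2))
    ∷ ((0 ∷ 1 ∷ 1 ∷ [] , 0 , 1) , (1 ∷ 1 ∷ 1 ∷ [] , 1 , 1))
    ∷ ((0 ∷ 1 ∷ 1 ∷ [] , 1 , 2) , (1 ∷ 1 ∷ 1 ∷ [] , 3 , 0))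
    ∷ [])
    ( ((1 ∷ 1 ∷ 1 ∷ [] , 1 , 2) , (0 ∷ 1 ∷ 1 ∷ [] , 2 , 2))
    ∷ ((1 ∷ 0 ∷ 1 ∷ [] , 1 , 1) , (1 ∷ 1 ∷ 0 ∷ [] , 3 , 0))
    ∷ ((0 ∷ 0 ∷ 0 ∷ [] , 1 , 2) , (1 ∷ 0 ∷ 0 ∷ [] , 1 , 1))
    ∷ ((1 ∷ 0 ∷ 0 ∷ [] , 1 , 2) , (1 ∷ 1 ∷ 1 ∷ [] , 2 , 2))
    ∷ ((1 ∷ 1 ∷ 0 ∷ [] , 1 , 2) , (0 ∷ 0 ∷ 0 ∷ [] , 1 , 1))
    ∷ ((0 ∷ 0 ∷ 1 ∷ [] , 1 , 2) , (1 ∷ 1 ∷ 0 ∷ [] , 0 , 1))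
    ∷ ((1 ∷ 1 ∷ 0 ∷ [] , 1 , 1) , (1 ∷ 1 ∷ 1 ∷ [] , 3 , 2))
    ∷ ((0 ∷ 0 ∷ 1 ∷ [] , 1 , 1) , (0 ∷ 0 ∷ 0 ∷ [] , 0 , 2))
    ∷ ((1 ∷ 0 ∷ 1 ∷ [] , 1 , 0) , (1 ∷ 1 ∷ 1 ∷ [] , 3 , 1))
    ∷ ((0 ∷ 0 ∷ 0 ∷ [] , 1 , 0) , (0 ∷ 0 ∷ 0 ∷ [] , 2 , 1))
    ∷ ((0 ∷ 1 ∷ 0 ∷ [] , 1 , 0) , (1 ∷ 0 ∷ 1 ∷ [] , 0 , 1))
    ∷ ((0 ∷ 1 ∷ 1 ∷ [] , 1 , 0) , (0 ∷ 0 ∷ 1 ∷ [] , 1 , 1))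
    ∷ ((1 ∷ 0 ∷ 0 ∷ [] , 1 , 0) , (1 ∷ 0 ∷ 0 ∷ [] , 1 , 2))
    ∷ ((0 ∷ 0 ∷ 1 ∷ [] , 1 , 0) , (1 ∷ 0 ∷ 0 ∷ [] , 0 , 2))
    ∷ ((1 ∷ 1 ∷ 0 ∷ [] , 1 , 0) , (0 ∷ 0 ∷ 1 ∷ [] , 3 , 1))
    ∷ ((0 ∷ 1 ∷ 0 ∷ [] , 1 , 2) , (0 ∷ 1 ∷ 0 ∷ [] , 2 , 2))
    ∷ ((0 ∷ 1 ∷ 0 ∷ [] , 1 , 1) , (0 ∷ 0 ∷ 1 ∷ [] , 1 , 0))
    ∷ ((1 ∷ 0 ∷ 0 ∷ [] , 1 , 1) , (0 ∷ 1 ∷ 0 ∷ [] , 3 , 2))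
    ∷ ((1 ∷ 0 ∷ 1 ∷ [] , 1 , 2) , (0 ∷ 1 ∷ 1 ∷ [] , 0 , 2))
    ∷ ((0 ∷ 0 ∷ 0 ∷ [] , 1 , 1) , (1 ∷ 0 ∷ 1 ∷ [] , 3 , 0))
    ∷ ((1 ∷ 0 ∷ 1 ∷ [] , 2 , 1) , (1 ∷ 1 ∷ 1 ∷ [] , 1 , 0))
    ∷ ((0 ∷ 1 ∷ 1 ∷ [] , 0 , 1) , (0 ∷ 0 ∷ 0 ∷ [] , 1 , 0))
    ∷ ((0 ∷ 1 ∷ 1 ∷ [] , 2 , 1) , (1 ∷ 0 ∷ 0 ∷ [] , 2 , 2))
    ∷ ((1 ∷ 0 ∷ 1 ∷ [] , 0 , 1) , (0 ∷ 1 ∷ 0 ∷ [] , 3 , 1))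
    ∷ ((0 ∷ 0 ∷ 1 ∷ [] , 2 , 1) , (0 ∷ 1 ∷ 1 ∷ [] , 3 , 0))
    ∷ ((0 ∷ 0 ∷ 0 ∷ [] , 0 , 1) , (1 ∷ 1 ∷ 0 ∷ [] , 3 , 2))
    ∷ ((0 ∷ 1 ∷ 0 ∷ [] , 2 , 1) , (0 ∷ 1 ∷ 1 ∷ [] , 1 , 1))
    ∷ ((1 ∷ 0 ∷ 0 ∷ [] , 0 , 1) , (0 ∷ 0 ∷ 1 ∷ [] , 0 , 2))
    ∷ ((0 ∷ 1 ∷ 1 ∷ [] , 1 , 1) , (1 ∷ 1 ∷ 1 ∷ [] , 0 , 2))
    ∷ ((1 ∷ 1 ∷ 1 ∷ [] , 2 , 1) , (0 ∷ 1 ∷ 0 ∷ [] , 3 , 0))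
    ∷ ((0 ∷ 1 ∷ 1 ∷ [] , 1 , 2) , (0 ∷ 0 ∷ 1 ∷ [] , 2 , 2))
    ∷ ((1 ∷ 1 ∷ 1 ∷ [] , 0 , 1) , (1 ∷ 1 ∷ 0 ∷ [] , 1 , 2))
    ∷ ((1 ∷ 1 ∷ 1 ∷ [] , 1 , 1) , (0 ∷ 1 ∷ 0 ∷ [] , 0 , 1))
    ∷ ((1 ∷ 1 ∷ 1 ∷ [] , 1 , 0) , (0 ∷ 1 ∷ 1 ∷ [] , 3 , 1))
    ∷ ((0 ∷ 1 ∷ 0 ∷ [] , 0 , 1) , (1 ∷ 0 ∷ 0 ∷ [] , 3 , 0))
    ∷ ((0 ∷ 0 ∷ 1 ∷ [] , 0 , 1) , (1 ∷ 0 ∷ 1 ∷ [] , 1 , 2))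
    ∷ ((1 ∷ 1 ∷ 0 ∷ [] , 0 , 1) , (1 ∷ 1 ∷ 0 ∷ [] , 2 , 2))
    ∷ ((1 ∷ 0 ∷ 0 ∷ [] , 2 , 1) , (1 ∷ 0 ∷ 1 ∷ [] , 2 , 2))
    ∷ ((1 ∷ 1 ∷ 0 ∷ [] , 2 , 1) , (1 ∷ 0 ∷ 1 ∷ [] , 3 , 2))
    ∷ ((0 ∷ 0 ∷ 0 ∷ [] , 2 , 1) , (0 ∷ 0 ∷ 0 ∷ [] , 1 , 2))
    ∷ [])

open BaseStages using (stage₁; stage₃)

lemma3p8 : (x y : ℕ) → (y ≡ 1 ⊎ y ≡ 2) → 2 ∣ x → 2 * y ≤ x → Grp.DFExists x y
lemma3p8 _ _ (inj₁ refl) (divides (suc m) refl) _ =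
  subst (λ x → Grp.DFExists x 1) (cong suc (+-comm (m * 2) 1)) (DFExists-from-stage 0 1 stage₁ m)
lemma3p8 _ _ (inj₂ refl) (divides (suc (suc m)) refl) _ =
  subst (λ x → Grp.DFExists x 2) (cong suc (+-comm (m * 2) 3)) (DFExists-from-stage 1 3 stage₃ m)
lemma3p8 _ _ (inj₁ refl) (divides 0 refl) ()
lemma3p8 _ _ (inj₂ refl) (divides 0 refl) ()
lemma3p8 _ _ (inj₂ refl) (divides 1 refl) (s≤s (s≤s ()))
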